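{- Let $q$ be a power of a prime $p\ge5$. Then $\Theta_{\rm c}=\emptyset$ if $q\equiv1\pmod 6$, and $\Theta_{\rm c}=\{27\}$ if $q\not\equiv1\pmod 6$.
   Context: $\mathbb F_q$ is the field with $q$ elements. Let $\Omega=\{(s,t)\in\mathbb F_q^2: t(1+s+t)\neq0\}$. For $(s,t)\in\Omega$ let $G_{s,t}(X)=X^4-2X^3-sX^2-2tX+t$ and $\theta(s,t)=\frac{s^3}{t(1+s+t)}$. Define $\Theta_{\rm c}=\{\theta(s,t):(s,t)\in\Omega,\ G_{s,t}\ \text{is the square of an irreducible quadratic over}\ \mathbb F_q\}$. -}

module Defs where

open import Level using (Level; _⊔_; suc)
open import Data.Nat using (ℕ; zero)
import Data.Nat as ℕ
open import Data.Fin using (Fin)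
open import Data.Product using (Σ; ∃; ∃-syntax; _×_; _,_)
open import Relation.Nullary using (¬_)
open import Algebra.Bundles using (CommutativeRing)
open import Function.Bundles using (Inverse)
import Relation.Binary.PropositionalEquality as P

record Field (c ℓ : Level) : Set (suc (c ⊔ ℓ)) where
  field
    commRing : CommutativeRing c ℓ
  open CommutativeRing commRing public
  field
    0≉1      : ¬ (0# ≈ 1#)
    inverse  : ∀ x → ¬ (x ≈ 0#) → ∃[ y ] (x * y ≈ 1#)

record FiniteField (c ℓ : Level) (q : ℕ) : Set (suc (c ⊔ ℓ)) where
  field
    fld      : Field c ℓ
  open Field fld public
  field
    card     : Inverse (P.setoid (Fin q)) setoid

module _ {c ℓ : Level} {q : ℕ} (F : FiniteField c ℓ q) where
  open FiniteField F

  ι : ℕ → Carrier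
  ι zero      = 0#
  ι (ℕ.suc n) = 1# + ι n

  -- Ω = { (s,t) : t (1+s+t) ≠ 0 }
  den : Carrier → Carrier → Carrier
  den s t = t * (1# + s + t)

  -- Coefficients of G_{s,t}(X) = X^4 - 2X^3 - sX^2 - 2tX + t
  -- are (1, -2, -s, -2t, t).  The polynomial  αX²+βX+γ  squared has
  -- coefficients (α², 2αβ, β²+2αγ, 2βγ, γ²).
  IsSquareOfQuadratic : Carrier → Carrier → Carrier → Carrier → Carrier → Set ℓ
  IsSquareOfQuadratic s t α β γ =
      (α * α ≈ 1#)
    × (ι 2 * α * β ≈ - ι 2)
    × (β * β + ι 2 * α * γ ≈ - s)
    × (ι 2 * β * γ ≈ - (ι 2 * t))
    × (γ * γ ≈ t)

  IrreducibleQuadratic : Carrier → Carrier → Carrier → Set (c ⊔ ℓ)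
  IrreducibleQuadratic α β γ =
      ¬ (α ≈ 0#)
    × ¬ (∃[ u ] ∃[ v ] ∃[ w ] ∃[ z ]
           (¬ (u ≈ 0#) × ¬ (w ≈ 0#)
            × (u * w ≈ α) × (u * z + v * w ≈ β) × (v * z ≈ γ)))

  GIsSquareOfIrreducible : Carrier → Carrier → Set (c ⊔ ℓ)
  GIsSquareOfIrreducible s t =
    ∃[ α ] ∃[ β ] ∃[ γ ] (IrreducibleQuadratic α β γ × IsSquareOfQuadratic s t α β γ)

  -- θ ∈ Θ_c  iff  θ = s³ / (t(1+s+t)) for some (s,t) ∈ Ω with G_{s,t} the
  -- square of an irreducible quadratic.  (θ = a/d with d ≠ 0 means θ·d = a.)
  InΘc : Carrier → Set (c ⊔ ℓ)
  InΘc θ = ∃[ s ] ∃[ t ]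
      (¬ (den s t ≈ 0#)
     × GIsSquareOfIrreducible s t
     × (θ * den s t ≈ s * s * s))

-- Over a field of odd characteristic, (αX² + βX + γ)² = X⁴ − 2X³ − sX² − 2tX + t with t ≠ 0
-- forces β = −α, γ = α, t = 1 and s = −3, so the quadratic is αΦ₆ with Φ₆ = X² − X + 1 and
-- θ = (−3)³ / (1 · (−1)) = 27; conversely (s, t) = (−3, 1) works as soon as Φ₆ has no root.
-- Hence Θc is {27} when Φ₆ has no root in F_q and empty otherwise.
--
-- Which case occurs is decided by counting: a fixed-point-free permutation of prime order d
-- of a finite set has d ∣ its size.  For x ↦ 1 + x this shows that d · 1 = 0 forces d ∣ q,
-- so 2 ≠ 0 and 3 ≠ 0 in F as p ≥ 5.  For a root ω of Φ₆, x ↦ −ωx on F ∖ {0} gives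
-- q ≡ 1 (mod 3).  The Möbius map x ↦ 1/(1 − x) has order 3, cycles 0 ↦ 1 ↦ ∞ and fixes
-- exactly the roots of Φ₆, so on F ∖ {0, 1} it gives q ≡ 2 (mod 3) when Φ₆ has no root.
-- Finally q is odd, so q ≡ 1 (mod 6) iff q ≡ 1 (mod 3).

module Submission where

open import Defs
open import Level using (Level)
open import Data.Nat using (ℕ; _^_; _≤_; _%_)
open import Data.Nat.Primality using (Prime)
open import Data.Product using (_×_)
open import Relation.Binary.PropositionalEquality using (_≡_; _≢_)
open import Relation.Nullary using (¬_)
open import Function.Bundles using (_⇔_)

open import Level using (_⊔_)
open import Algebra.Bundles using (CommutativeRing)
open import Data.Empty using (⊥)
open import Data.Fin using (Fin; toℕ; fromℕ<)
import Data.Fin.Properties as Fin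
import Data.Integer as ℤ
import Data.Integer.Properties as ℤ
open import Data.List using (List; []; _∷_; _++_; length; map; filter; tabulate; allFin)
open import Data.List.Properties using (length-++; length-map; length-tabulate)
open import Data.List.Membership.Propositional using (_∈_; _∉_)
open import Data.List.Membership.Propositional.Properties
  using (∈-filter⁺; ∈-filter⁻; ∈-++⁺ˡ; ∈-++⁺ʳ; ∈-++⁻; ∈-tabulate⁺; ∈-tabulate⁻; ∈-map⁺; ∈-map⁻; ∈-allFin)
open import Data.List.Membership.Propositional.Properties.WithK using (unique∧set⇒bag)
open import Data.List.Relation.Binary.BagAndSetEquality using (∼bag⇒↭)
open import Data.List.Relation.Binary.Permutation.Propositional.Properties using (↭-length)
open import Data.List.Relation.Binary.Subset.Propositional using (_⊆_)
open import Data.List.Relation.Unary.All as All using (All; []; _∷_)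
open import Data.List.Relation.Unary.AllPairs as AllPairs using (AllPairs; []; _∷_)
import Data.List.Relation.Unary.AllPairs.Properties as AllPairs
open import Data.List.Relation.Unary.Any using (here; there)
open import Data.List.Relation.Unary.Unique.Propositional using (Unique)
import Data.List.Relation.Unary.Unique.Propositional.Properties as Unique
open import Data.Maybe using (Maybe; just; nothing)
open import Data.Nat as ℕ using (zero; suc)
import Data.Nat.Properties as ℕ
open import Data.Nat.Coprimality using (prime⇒coprime; coprime-Bézout)
open import Data.Nat.DivMod using (m≡m%n+[m/n]*n; m%n<n; [m+kn]%n≡m%n; m∣n⇒o%n%m≡o%m)
open import Data.Nat.Divisibility using (_∣_; divides; _∣0; ∣-refl; ∣m∣n⇒∣m+n; ∣1⇒≡1; m%n≡0⇒n∣m)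
open import Data.Nat.GCD using (module Bézout)
open import Data.Nat.Induction using (<-wellFounded)
open import Data.Nat.Primality using (prime?; prime[2]; ¬prime[1]; prime⇒nonZero; prime⇒irreducible; euclidsLemma)
open import Data.Product using (_,_; proj₁; proj₂; uncurry; ∃-syntax)
import Data.Sign as Sign
open import Data.Sum using ([_,_]; inj₁; inj₂)
open import Function using (_∘_; _$_)
open import Function.Bundles using (Inverse; Equivalence; mk⇔)
import Function.Endo.Propositional
import Algebra.Solver.Ring
open import Induction.WellFounded using (Acc; acc)
open import Relation.Binary.Definitions using (DecidableEquality; tri<; tri≈; tri>)
import Relation.Binary.PropositionalEquality as ≡
open import Relation.Nullary using (Dec; yes; no; contradiction)
import Relation.Nullary.Decidable as Dec


prime[3] : Prime 3
prime[3] = Dec.from-yes (prime? 3)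

prime∤prime^ : ∀ {p r} → Prime p → Prime r → r ≢ p → ∀ k → ¬ r ∣ p ^ k
prime∤prime^ p-prime r-prime r≢p zero    r∣1 = ¬prime[1] (≡.subst Prime (∣1⇒≡1 r∣1) r-prime)
prime∤prime^ {p} p-prime r-prime r≢p (suc k) r∣pᵏ⁺¹ with euclidsLemma p (p ^ k) r-prime r∣pᵏ⁺¹
... | inj₁ r∣p  = [ ¬prime[1] ∘ (λ r≡1 → ≡.subst Prime r≡1 r-prime) , r≢p ] (prime⇒irreducible p-prime r∣p)
... | inj₂ r∣pᵏ = prime∤prime^ p-prime r-prime r≢p k r∣pᵏ

n≡r+m*d⇒n%d≡r%d : ∀ {n r d} .{{_ : ℕ.NonZero d}} → ∃[ m ] n ≡ r ℕ.+ m ℕ.* d → n % d ≡ r % d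
n≡r+m*d⇒n%d≡r%d {r = r} {d} (m , n≡r+md) = ≡.trans (≡.cong (_% d) n≡r+md) ([m+kn]%n≡m%n r m d)

%6≡1⇔%3≡1 : ∀ n → ¬ 2 ∣ n → n % 6 ≡ 1 ⇔ n % 3 ≡ 1
%6≡1⇔%3≡1 n 2∤n = mk⇔
  (λ n%6≡1 → ≡.trans (≡.sym n%6%3≡n%3) (≡.cong (_% 3) n%6≡1))
  (λ n%3≡1 → residue (n % 6) (m%n<n n 6) (≡.trans n%6%3≡n%3 n%3≡1)
                     (2∤n ∘ m%n≡0⇒n∣m n 2 ∘ ≡.trans (≡.sym n%6%2≡n%2)))
  where
  n%6%3≡n%3 : n % 6 % 3 ≡ n % 3
  n%6%3≡n%3 = m∣n⇒o%n%m≡o%m 3 6 n (divides 2 ≡.refl)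
  n%6%2≡n%2 : n % 6 % 2 ≡ n % 2
  n%6%2≡n%2 = m∣n⇒o%n%m≡o%m 2 6 n (divides 3 ≡.refl)
  residue : ∀ r → r ℕ.< 6 → r % 3 ≡ 1 → r % 2 ≢ 0 → r ≡ 1
  residue 0 _ () _
  residue 1 _ _  _       = ≡.refl
  residue 2 _ () _
  residue 3 _ () _
  residue 4 _ _  4%2≢0   = contradiction ≡.refl 4%2≢0
  residue 5 _ () _
  residue (suc (suc (suc (suc (suc (suc _)))))) (ℕ.s≤s (ℕ.s≤s (ℕ.s≤s (ℕ.s≤s (ℕ.s≤s (ℕ.s≤s ())))))) _ _


module _ {a} {A : Set a} (_≟_ : DecidableEquality A) where

  open ≡ using (refl; sym; trans; cong; cong-app; subst; module ≡-Reasoning)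
  open import Data.Nat using (pred; _+_; _*_; _∸_; _<_; _/_; NonZero; >-nonZero; >-nonZero⁻¹)
  open import Data.List.Membership.DecPropositional _≟_ using (_∈?_; _∉?_)

  length-++-filter-∉ : ∀ {xs ys} → Unique xs → Unique ys → ys ⊆ xs →
                       length xs ≡ length ys + length (filter (_∉? ys) xs)
  length-++-filter-∉ {xs} {ys} xs! ys! ys⊆xs = trans
    (↭-length (∼bag⇒↭ (unique∧set⇒bag xs! (Unique.++⁺ ys! rest! disjoint) (mk⇔ split join))))
    (length-++ ys)
    where
    rest! : Unique (filter (_∉? ys) xs)
    rest! = Unique.filter⁺ (_∉? ys) xs!
    disjoint : ∀ {v} → ¬ (v ∈ ys × v ∈ filter (_∉? ys) xs)
    disjoint (v∈ys , v∈rest) = proj₂ (∈-filter⁻ (_∉? ys) {xs = xs} v∈rest) v∈ys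
    split : ∀ {v} → v ∈ xs → v ∈ ys ++ filter (_∉? ys) xs
    split {v} v∈xs with v ∈? ys
    ... | yes v∈ys = ∈-++⁺ˡ v∈ys
    ... | no v∉ys  = ∈-++⁺ʳ ys (∈-filter⁺ (_∉? ys) v∈xs v∉ys)
    join : ∀ {v} → v ∈ ys ++ filter (_∉? ys) xs → v ∈ xs
    join = [ ys⊆xs , proj₁ ∘ ∈-filter⁻ (_∉? ys) {xs = xs} ] ∘ ∈-++⁻ ys

  module _ (f : A → A) where

    open import Function.Endo.Propositional A using (^-homo) renaming (_^_ to _^[_])

    ^[+] : ∀ m n {x} → (f ^[ m + n ]) x ≡ (f ^[ m ]) ((f ^[ n ]) x)
    ^[+] m n {x} = cong-app (^-homo f m n) x

    ^-preserves : ∀ {p} (P : A → Set p) → (∀ {x} → P x → P (f x)) → ∀ n {x} → P x → P ((f ^[ n ]) x)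
    ^-preserves P f-preserves zero    Px = Px
    ^-preserves P f-preserves (suc n) Px = f-preserves (^-preserves P f-preserves n Px)

    ^-periodic : ∀ {n x} → (f ^[ n ]) x ≡ x → ∀ m → (f ^[ m * n ]) x ≡ x
    ^-periodic         fⁿx≡x zero    = refl
    ^-periodic {n} {x} fⁿx≡x (suc m) = begin
      (f ^[ n + m * n ]) x          ≡⟨ ^[+] n (m * n) {x} ⟩
      (f ^[ n ]) ((f ^[ m * n ]) x) ≡⟨ cong (f ^[ n ]) (^-periodic fⁿx≡x m) ⟩
      (f ^[ n ]) x                  ≡⟨ fⁿx≡x ⟩
      x                             ∎
      where open ≡-Reasoning

    coprime-periods⇒fixed : ∀ {m n x} → Bézout.Identity 1 m n →
                            (f ^[ m ]) x ≡ x → (f ^[ n ]) x ≡ x → f x ≡ x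
    coprime-periods⇒fixed {m} {n} {x} (Bézout.+- i j 1+jn≡im) fᵐx≡x fⁿx≡x = begin
      f x                  ≡⟨ cong f (^-periodic fⁿx≡x j) ⟨
      (f ^[ 1 + j * n ]) x ≡⟨ cong (λ k → (f ^[ k ]) x) 1+jn≡im ⟩
      (f ^[ i * m ]) x     ≡⟨ ^-periodic fᵐx≡x i ⟩
      x                    ∎
      where open ≡-Reasoning
    coprime-periods⇒fixed (Bézout.-+ i j 1+im≡jn) fᵐx≡x fⁿx≡x =
      coprime-periods⇒fixed (Bézout.+- j i 1+im≡jn) fⁿx≡x fᵐx≡x

    orbit : ℕ → A → List A
    orbit d x = tabulate {n = d} (λ i → (f ^[ toℕ i ]) x)

    module _ {d} (d-prime : Prime d) where

      private instance
        d≢0 : NonZero d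
        d≢0 = prime⇒nonZero d-prime

      record FixedPointFreeOfOrder (xs : List A) : Set a where
        field
          unique         : Unique xs
          closed         : ∀ {x} → x ∈ xs → f x ∈ xs
          periodic       : ∀ {x} → x ∈ xs → (f ^[ d ]) x ≡ x
          fixedPointFree : ∀ {x} → x ∈ xs → f x ≢ x

      prime-period⇒fixed : ∀ {k x} → 0 < k → k < d → (f ^[ d ]) x ≡ x → (f ^[ k ]) x ≡ x → f x ≡ x
      prime-period⇒fixed 0<k k<d =
        coprime-periods⇒fixed (coprime-Bézout (prime⇒coprime d-prime {{>-nonZero 0<k}} k<d))

      module _ {xs} (xs-fpf : FixedPointFreeOfOrder xs) {x} (x∈xs : x ∈ xs) where

        open FixedPointFreeOfOrder xs-fpf

        orbit⊆ : orbit d x ⊆ xs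
        orbit⊆ y∈orbit with i , refl ← ∈-tabulate⁻ y∈orbit = ^-preserves (_∈ xs) closed (toℕ i) x∈xs

        ∈-orbit : ∀ n → (f ^[ n ]) x ∈ orbit d x
        ∈-orbit n = subst (_∈ orbit d x) fⁿ⁻x≡fⁿx (∈-tabulate⁺ (fromℕ< (m%n<n n d)))
          where
          open ≡-Reasoning
          fⁿ⁻x≡fⁿx : (f ^[ toℕ (fromℕ< (m%n<n n d)) ]) x ≡ (f ^[ n ]) x
          fⁿ⁻x≡fⁿx = begin
            (f ^[ toℕ (fromℕ< (m%n<n n d)) ]) x     ≡⟨ cong (λ k → (f ^[ k ]) x) (Fin.toℕ-fromℕ< (m%n<n n d)) ⟩
            (f ^[ n % d ]) x                        ≡⟨ cong (f ^[ n % d ]) (^-periodic (periodic x∈xs) (n / d)) ⟨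
            (f ^[ n % d ]) ((f ^[ (n / d) * d ]) x) ≡⟨ ^[+] (n % d) ((n / d) * d) ⟨
            (f ^[ n % d + (n / d) * d ]) x          ≡⟨ cong (λ k → (f ^[ k ]) x) (m≡m%n+[m/n]*n n d) ⟨
            (f ^[ n ]) x                            ∎

        ∈-orbit⁻ : ∀ {y} → y ∈ xs → f y ∈ orbit d x → y ∈ orbit d x
        ∈-orbit⁻ {y} y∈xs fy∈orbit with i , fy≡fⁱx ← ∈-tabulate⁻ fy∈orbit =
          subst (_∈ orbit d x) fⁿx≡y (∈-orbit (pred d + toℕ i))
          where
          open ≡-Reasoning
          fⁿx≡y : (f ^[ pred d + toℕ i ]) x ≡ y
          fⁿx≡y = begin
            (f ^[ pred d + toℕ i ]) x          ≡⟨ ^[+] (pred d) (toℕ i) ⟩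
            (f ^[ pred d ]) ((f ^[ toℕ i ]) x) ≡⟨ cong (f ^[ pred d ]) fy≡fⁱx ⟨
            (f ^[ pred d ]) (f y)              ≡⟨ ^[+] (pred d) 1 ⟨
            (f ^[ pred d + 1 ]) y              ≡⟨ cong (λ k → (f ^[ k ]) y) (trans (ℕ.+-comm (pred d) 1) (ℕ.suc-pred d)) ⟩
            (f ^[ d ]) y                       ≡⟨ periodic y∈xs ⟩
            y                                  ∎

        orbit-≢ : ∀ {m n} → m < n → n < d → (f ^[ m ]) x ≢ (f ^[ n ]) x
        orbit-≢ {m} {n} m<n n<d fᵐx≡fⁿx = fixedPointFree fᵐx∈xs
          (prime-period⇒fixed (ℕ.m<n⇒0<n∸m m<n) (ℕ.≤-<-trans (ℕ.m∸n≤m n m) n<d) (periodic fᵐx∈xs) period)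
          where
          open ≡-Reasoning
          fᵐx∈xs : (f ^[ m ]) x ∈ xs
          fᵐx∈xs = ^-preserves (_∈ xs) closed m x∈xs
          period : (f ^[ n ∸ m ]) ((f ^[ m ]) x) ≡ (f ^[ m ]) x
          period = begin
            (f ^[ n ∸ m ]) ((f ^[ m ]) x) ≡⟨ ^[+] (n ∸ m) m ⟨
            (f ^[ n ∸ m + m ]) x          ≡⟨ cong (λ k → (f ^[ k ]) x) (ℕ.m∸n+n≡m (ℕ.<⇒≤ m<n)) ⟩
            (f ^[ n ]) x                  ≡⟨ fᵐx≡fⁿx ⟨
            (f ^[ m ]) x                  ∎

        orbit-unique : Unique (orbit d x)
        orbit-unique = Unique.tabulate⁺ injective
          where
          injective : ∀ {i j : Fin d} → (f ^[ toℕ i ]) x ≡ (f ^[ toℕ j ]) x → i ≡ j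
          injective {i} {j} eq with ℕ.<-cmp (toℕ i) (toℕ j)
          ... | tri< i<j _ _ = contradiction eq (orbit-≢ i<j (Fin.toℕ<n j))
          ... | tri≈ _ i≡j _ = Fin.toℕ-injective i≡j
          ... | tri> _ _ j<i = contradiction (sym eq) (orbit-≢ j<i (Fin.toℕ<n i))

      prime∣length : ∀ {xs} → FixedPointFreeOfOrder xs → d ∣ length xs
      prime∣length {xs} xs-fpf = go xs-fpf (<-wellFounded (length xs))
        where
        go : ∀ {xs} → FixedPointFreeOfOrder xs → Acc _<_ (length xs) → d ∣ length xs
        go {[]}         _      _        = d ∣0
        go {xs@(x ∷ _)} xs-fpf (acc rs) =
          subst (d ∣_) (sym length-xs) (∣m∣n⇒∣m+n ∣-refl (go rest-fpf (rs rest<xs)))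
          where
          open FixedPointFreeOfOrder xs-fpf
          x∈xs : x ∈ xs
          x∈xs = here refl
          rest : List A
          rest = filter (_∉? orbit d x) xs
          rest⊆xs : ∀ {y} → y ∈ rest → y ∈ xs
          rest⊆xs = proj₁ ∘ ∈-filter⁻ (_∉? orbit d x) {xs = xs}
          length-xs : length xs ≡ d + length rest
          length-xs = trans (length-++-filter-∉ unique (orbit-unique xs-fpf x∈xs) (orbit⊆ xs-fpf x∈xs))
                            (cong (_+ length rest) (length-tabulate _))
          rest<xs : length rest < length xs
          rest<xs = subst (length rest <_) (sym length-xs) (ℕ.m<n+m (length rest) (>-nonZero⁻¹ d))
          rest-closed : ∀ {y} → y ∈ rest → f y ∈ rest
          rest-closed y∈rest with y∈xs , y∉orbit ← ∈-filter⁻ (_∉? orbit d x) {xs = xs} y∈rest =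
            ∈-filter⁺ (_∉? orbit d x) (closed y∈xs) (y∉orbit ∘ ∈-orbit⁻ xs-fpf x∈xs y∈xs)
          rest-fpf : FixedPointFreeOfOrder rest
          rest-fpf = record
            { unique         = Unique.filter⁺ (_∉? orbit d x) unique
            ; closed         = rest-closed
            ; periodic       = periodic ∘ rest⊆xs
            ; fixedPointFree = fixedPointFree ∘ rest⊆xs
            }


module IntegerCoefficients {c ℓ} (R : CommutativeRing c ℓ) where

  open import Data.Integer using (ℤ; +_; -[1+_])
  open CommutativeRing R
  open import Algebra.Properties.Ring ring using (-0#≈0#; -‿+-comm; -‿involutive; -‿distribˡ-*; -‿distribʳ-*)
  open import Algebra.Properties.Semiring.Mult.TCOptimised semiring
    using (×-homo-+; ×1-homo-*; 1+×) renaming (_×_ to _×′_)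
  open import Algebra.Properties.CommutativeSemigroup +-commutativeSemigroup using (interchange)
  open import Algebra.Solver.Ring.AlmostCommutativeRing using (fromCommutativeRing; _-Raw-AlmostCommutative⟶_)
  open import Relation.Binary.Reasoning.Setoid setoid

  private
    ⟦_⟧ : ℤ → Carrier
    ⟦ + n      ⟧ = n ×′ 1#
    ⟦ -[1+ n ] ⟧ = - (suc n ×′ 1#)

    [1+a]-[1+b]≈a-b : ∀ a b → (1# + a) - (1# + b) ≈ a - b
    [1+a]-[1+b]≈a-b a b = begin
      (1# + a) + - (1# + b)   ≈⟨ +-congˡ (-‿+-comm 1# b) ⟨
      (1# + a) + (- 1# + - b) ≈⟨ interchange 1# a (- 1#) (- b) ⟩
      (1# - 1#) + (a - b)     ≈⟨ +-congʳ (-‿inverseʳ 1#) ⟩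
      0# + (a - b)            ≈⟨ +-identityˡ (a - b) ⟩
      a - b                   ∎

    -x*-y≈x*y : ∀ x y → - x * - y ≈ x * y
    -x*-y≈x*y x y = begin
      - x * - y     ≈⟨ -‿distribˡ-* x (- y) ⟨
      - (x * - y)   ≈⟨ -‿cong (-‿distribʳ-* x y) ⟨
      - - (x * y)   ≈⟨ -‿involutive (x * y) ⟩
      x * y         ∎

    ⟦⊖⟧ : ∀ m n → ⟦ m ℤ.⊖ n ⟧ ≈ m ×′ 1# - n ×′ 1#
    ⟦⊖⟧ zero    zero    = sym (trans (+-identityˡ (- 0#)) -0#≈0#)
    ⟦⊖⟧ (suc m) zero    = sym (trans (+-congˡ -0#≈0#) (+-identityʳ _))
    ⟦⊖⟧ zero    (suc n) = sym (+-identityˡ _)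
    ⟦⊖⟧ (suc m) (suc n) = begin
      ⟦ suc m ℤ.⊖ suc n ⟧             ≡⟨ ≡.cong ⟦_⟧ (ℤ.[1+m]⊖[1+n]≡m⊖n m n) ⟩
      ⟦ m ℤ.⊖ n ⟧                     ≈⟨ ⟦⊖⟧ m n ⟩
      m ×′ 1# - n ×′ 1#               ≈⟨ [1+a]-[1+b]≈a-b (m ×′ 1#) (n ×′ 1#) ⟨
      (1# + m ×′ 1#) - (1# + n ×′ 1#) ≈⟨ +-cong (1+× m 1#) (-‿cong (1+× n 1#)) ⟨
      suc m ×′ 1# - suc n ×′ 1#       ∎

    ⟦+◃⟧ : ∀ n → ⟦ Sign.+ ℤ.◃ n ⟧ ≈ n ×′ 1#
    ⟦+◃⟧ zero    = refl
    ⟦+◃⟧ (suc n) = refl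

    ⟦-◃⟧ : ∀ n → ⟦ Sign.- ℤ.◃ n ⟧ ≈ - (n ×′ 1#)
    ⟦-◃⟧ zero    = sym -0#≈0#
    ⟦-◃⟧ (suc n) = refl

    ⟦+⟧ : ∀ i j → ⟦ i ℤ.+ j ⟧ ≈ ⟦ i ⟧ + ⟦ j ⟧
    ⟦+⟧ (+ m)    (+ n)    = ×-homo-+ 1# m n
    ⟦+⟧ (+ m)    -[1+ n ] = ⟦⊖⟧ m (suc n)
    ⟦+⟧ -[1+ m ] (+ n)    = trans (⟦⊖⟧ n (suc m)) (+-comm _ _)
    ⟦+⟧ -[1+ m ] -[1+ n ] = begin
      - (suc (suc (m ℕ.+ n)) ×′ 1#)     ≡⟨ ≡.cong (λ k → - (k ×′ 1#)) (ℕ.+-suc (suc m) n) ⟨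
      - ((suc m ℕ.+ suc n) ×′ 1#)       ≈⟨ -‿cong (×-homo-+ 1# (suc m) (suc n)) ⟩
      - (suc m ×′ 1# + suc n ×′ 1#)     ≈⟨ -‿+-comm _ _ ⟨
      - (suc m ×′ 1#) + - (suc n ×′ 1#) ∎

    ⟦*⟧ : ∀ i j → ⟦ i ℤ.* j ⟧ ≈ ⟦ i ⟧ * ⟦ j ⟧
    ⟦*⟧ (+ m)    (+ n)    = trans (⟦+◃⟧ (m ℕ.* n)) (×1-homo-* m n)
    ⟦*⟧ (+ m)    -[1+ n ] =
      trans (⟦-◃⟧ (m ℕ.* suc n)) (trans (-‿cong (×1-homo-* m (suc n))) (-‿distribʳ-* _ _))
    ⟦*⟧ -[1+ m ] (+ n)    =
      trans (⟦-◃⟧ (suc m ℕ.* n)) (trans (-‿cong (×1-homo-* (suc m) n)) (-‿distribˡ-* _ _))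
    ⟦*⟧ -[1+ m ] -[1+ n ] =
      trans (⟦+◃⟧ (suc m ℕ.* suc n)) (trans (×1-homo-* (suc m) (suc n)) (sym (-x*-y≈x*y _ _)))

    ⟦-⟧ : ∀ i → ⟦ ℤ.- i ⟧ ≈ - ⟦ i ⟧
    ⟦-⟧ (+ zero)  = sym -0#≈0#
    ⟦-⟧ (+ suc n) = refl
    ⟦-⟧ -[1+ n ]  = sym (-‿involutive _)

    homomorphism : ℤ.+-*-rawRing -Raw-AlmostCommutative⟶ fromCommutativeRing R
    homomorphism = record
      { ⟦_⟧ = ⟦_⟧ ; +-homo = ⟦+⟧ ; *-homo = ⟦*⟧ ; -‿homo = ⟦-⟧ ; 0-homo = refl ; 1-homo = refl }

    ⟦⟧-≟ : ∀ i j → Maybe (⟦ i ⟧ ≈ ⟦ j ⟧)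
    ⟦⟧-≟ i j with i ℤ.≟ j
    ... | yes ≡.refl = just refl
    ... | no _       = nothing

    module Solver = Algebra.Solver.Ring ℤ.+-*-rawRing (fromCommutativeRing R) homomorphism ⟦⟧-≟

  open Solver public using (Polynomial; solve; _:=_; _:+_; _:*_; _:-_; :-_)

  #_ : ∀ {n} → ℕ → Polynomial n
  # k = Solver.con (+ k)


module FieldProperties {c ℓ} (K : Field c ℓ) where

  open Field K
  open import Relation.Binary.Reasoning.Setoid setoid

  1≉0 : ¬ 1# ≈ 0#
  1≉0 = 0≉1 ∘ sym

  *-cancelˡ : ∀ {a x y} → ¬ a ≈ 0# → a * x ≈ a * y → x ≈ y
  *-cancelˡ {a} {x} {y} a≉0 ax≈ay = begin
    x             ≈⟨ a⁻¹[az]≈z x ⟨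
    a⁻¹ * (a * x) ≈⟨ *-congˡ ax≈ay ⟩
    a⁻¹ * (a * y) ≈⟨ a⁻¹[az]≈z y ⟩
    y             ∎
    where
    a⁻¹ : Carrier
    a⁻¹ = proj₁ (inverse a a≉0)
    a⁻¹[az]≈z : ∀ z → a⁻¹ * (a * z) ≈ z
    a⁻¹[az]≈z z = begin
      a⁻¹ * (a * z) ≈⟨ *-assoc a⁻¹ a z ⟨
      (a⁻¹ * a) * z ≈⟨ *-congʳ (trans (*-comm a⁻¹ a) (proj₂ (inverse a a≉0))) ⟩
      1# * z        ≈⟨ *-identityˡ z ⟩
      z             ∎


module _ {c ℓ q} (F : FiniteField c ℓ q) where

  open FiniteField F
  open FieldProperties fld
  open IntegerCoefficients commRing
  open import Algebra.Properties.Ring ring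
    using (x∙y⁻¹≈ε⇒x≈y; x≈y⇒x∙y⁻¹≈ε; +-identityˡ-unique; -‿involutive; -‿distribʳ-*; -‿injective; -0#≈0#)
  open import Algebra.Properties.Semiring.Mult.TCOptimised semiring using (1+×) renaming (_×_ to _×′_)
  open import Relation.Binary.Reasoning.Setoid setoid
  open import Function.Endo.Propositional Carrier using () renaming (_^_ to _^[_])
  private module FinEndo = Function.Endo.Propositional (Fin q)

  -- The numeral n of the ring solver denotes n ×′ 1#, which is not syntactically ι F n.
  ι≈n×1 : ∀ n → ι F n ≈ n ×′ 1#
  ι≈n×1 zero    = refl
  ι≈n×1 (suc n) = trans (+-congˡ (ι≈n×1 n)) (sym (1+× n 1#))

  private
    enc : Carrier → Fin q
    enc = Inverse.from card

    dec : Fin q → Carrier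
    dec = Inverse.to card

    dec-enc : ∀ x → dec (enc x) ≈ x
    dec-enc = Inverse.strictlyInverseˡ card

    enc-dec : ∀ i → enc (dec i) ≡ i
    enc-dec = Inverse.strictlyInverseʳ card

    enc-cong : ∀ {x y} → x ≈ y → enc x ≡ enc y
    enc-cong = Inverse.from-cong card

    enc-injective : ∀ {x y} → enc x ≡ enc y → x ≈ y
    enc-injective {x} {y} eq = trans (sym (dec-enc x)) (trans (reflexive (≡.cong dec eq)) (dec-enc y))

  _≈?_ : ∀ x y → Dec (x ≈ y)
  x ≈? y = Dec.map′ enc-injective enc-cong (enc x Fin.≟ enc y)

  card≡length[mod] : ∀ {d} → Prime d →
    (σ : Carrier → Carrier) → (∀ {x y} → x ≈ y → σ x ≈ σ y) →
    (ws : List Carrier) → AllPairs _≉_ ws →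
    (∀ {x} → All (x ≉_) ws → All (σ x ≉_) ws) →
    (∀ {x} → All (x ≉_) ws → (σ ^[ d ]) x ≈ x) →
    (∀ {x} → All (x ≉_) ws → ¬ σ x ≈ x) →
    ∃[ m ] q ≡ length ws ℕ.+ m ℕ.* d
  card≡length[mod] {d} d-prime σ σ-cong ws ws-distinct σ-outside σ-order σ-fixedPointFree =
    quotient , ≡.trans q≡ws+rest (≡.cong (length ws ℕ.+_) equality)
    where
    open import Data.List.Membership.DecPropositional Fin._≟_ using (_∉?_)

    σ̂ : Fin q → Fin q
    σ̂ i = enc (σ (dec i))

    ŵs rest : List (Fin q)
    ŵs   = map enc ws
    rest = filter (_∉? ŵs) (allFin q)

    rest⇒outside : ∀ {i} → i ∈ rest → All (dec i ≉_) ws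
    rest⇒outside {i} i∈rest = All.tabulate λ {w} w∈ws dec-i≈w → i∉ŵs
      (≡.subst (_∈ ŵs) (≡.trans (enc-cong (sym dec-i≈w)) (enc-dec i)) (∈-map⁺ enc w∈ws))
      where
      i∉ŵs : i ∉ ŵs
      i∉ŵs = proj₂ (∈-filter⁻ (_∉? ŵs) {xs = allFin q} i∈rest)

    outside⇒rest : ∀ {i} → All (dec i ≉_) ws → i ∈ rest
    outside⇒rest {i} i-outside = ∈-filter⁺ (_∉? ŵs) (∈-allFin i) i∉ŵs
      where
      i∉ŵs : i ∉ ŵs
      i∉ŵs i∈ŵs with w , w∈ws , ≡.refl ← ∈-map⁻ enc i∈ŵs = All.lookup i-outside w∈ws (dec-enc w)

    σ̂-iterate : ∀ n i → (σ̂ FinEndo.^ n) i ≡ enc ((σ ^[ n ]) (dec i))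
    σ̂-iterate zero    i = ≡.sym (enc-dec i)
    σ̂-iterate (suc n) i = ≡.trans (≡.cong σ̂ (σ̂-iterate n i)) (enc-cong (σ-cong (dec-enc _)))

    rest-fixedPointFree : FixedPointFreeOfOrder Fin._≟_ σ̂ d-prime rest
    rest-fixedPointFree = record
      { unique         = Unique.filter⁺ (_∉? ŵs) (Unique.allFin⁺ q)
      ; closed         = λ i∈rest → outside⇒rest
          (All.map (λ σx≉w dσ̂x≈w → σx≉w (trans (sym (dec-enc _)) dσ̂x≈w)) (σ-outside (rest⇒outside i∈rest)))
      ; periodic       = λ {i} i∈rest → ≡.trans (σ̂-iterate d i)
          (≡.trans (enc-cong (σ-order (rest⇒outside i∈rest))) (enc-dec i))
      ; fixedPointFree = λ i∈rest σ̂i≡i → σ-fixedPointFree (rest⇒outside i∈rest)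
          (trans (sym (dec-enc _)) (reflexive (≡.cong dec σ̂i≡i)))
      }

    open _∣_ (prime∣length Fin._≟_ σ̂ d-prime rest-fixedPointFree)

    q≡ws+rest : q ≡ length ws ℕ.+ length rest
    q≡ws+rest = ≡.trans (≡.sym (length-tabulate _)) (≡.trans
      (length-++-filter-∉ Fin._≟_ (Unique.allFin⁺ q) ŵs-unique (λ _ → ∈-allFin _))
      (≡.cong (ℕ._+ length rest) (length-map enc ws)))
      where
      ŵs-unique : Unique ŵs
      ŵs-unique = AllPairs.map⁺ (AllPairs.map (λ w≉w′ → w≉w′ ∘ enc-injective) ws-distinct)

  char∣card : ∀ {d} → Prime d → ι F d ≈ 0# → d ∣ q
  char∣card {d} d-prime d≈0 =
    uncurry divides (card≡length[mod] d-prime (1# +_) +-congˡ [] [] (λ _ → []) (λ _ → period) (λ _ → 1+x≉x))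
    where
    iterate : ∀ n {x} → ((1# +_) ^[ n ]) x ≈ ι F n + x
    iterate zero    {x} = sym (+-identityˡ x)
    iterate (suc n) {x} = trans (+-congˡ (iterate n)) (sym (+-assoc 1# (ι F n) x))
    period : ∀ {x} → ((1# +_) ^[ d ]) x ≈ x
    period {x} = trans (iterate d) (trans (+-congʳ d≈0) (+-identityˡ x))
    1+x≉x : ∀ {x} → ¬ 1# + x ≈ x
    1+x≉x {x} = 1≉0 ∘ +-identityˡ-unique 1# x

  Φ₆ : Carrier → Carrier
  Φ₆ x = x * x - x + 1#

  Φ₆-root⇒q%3≡1 : ¬ ι F 3 ≈ 0# → ∀ {ω} → Φ₆ ω ≈ 0# → q % 3 ≡ 1
  Φ₆-root⇒q%3≡1 3≉0 {ω} Φ₆ω≈0 = n≡r+m*d⇒n%d≡r%d $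
    card≡length[mod] prime[3] (ζ *_) *-congˡ (0# ∷ []) ([] ∷ [])
      (λ x-outside → ζx≉0 (All.head x-outside) ∷ []) (λ _ → ζ³x≈x _) (ζx≉x ∘ All.head)
    where
    ζ : Carrier
    ζ = - ω

    ζ³x≈x : ∀ x → ζ * (ζ * (ζ * x)) ≈ x
    ζ³x≈x x = begin
      ζ * (ζ * (ζ * x))       ≈⟨ solve 2 (λ ω x → (:- ω) :* ((:- ω) :* ((:- ω) :* x))
                                                 := x :- (ω :+ # 1) :* x :* (ω :* ω :- ω :+ # 1)) refl ω x ⟩
      x - (ω + 1#) * x * Φ₆ ω ≈⟨ +-congˡ (-‿cong (*-congˡ Φ₆ω≈0)) ⟩
      x - (ω + 1#) * x * 0#   ≈⟨ solve 2 (λ ω x → x :- (ω :+ # 1) :* x :* # 0 := x) refl ω x ⟩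
      x                       ∎

    ζx≉0 : ∀ {x} → ¬ x ≈ 0# → ¬ ζ * x ≈ 0#
    ζx≉0 x≉0 ζx≈0 = x≉0 (*-cancelˡ ζ≉0 (trans ζx≈0 (sym (zeroʳ ζ))))
      where
      ζ≉0 : ¬ ζ ≈ 0#
      ζ≉0 ζ≈0 = 1≉0 (trans (sym (ζ³x≈x 1#)) (trans (*-congʳ ζ≈0) (zeroˡ _)))

    ζx≉x : ∀ {x} → ¬ x ≈ 0# → ¬ ζ * x ≈ x
    ζx≉x {x} x≉0 ζx≈x = 3≉0 (begin
      ι F 3                            ≈⟨ ι≈n×1 3 ⟩
      3 ×′ 1#                          ≈⟨ solve 1 (λ ω → # 3 := (ω :* ω :- ω :+ # 1) :+ (ω :- # 2) :* ((:- ω) :- # 1)) refl ω ⟩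
      Φ₆ ω + (ω - 2 ×′ 1#) * (ζ - 1#)  ≈⟨ +-cong Φ₆ω≈0 (*-congˡ (x≈y⇒x∙y⁻¹≈ε ζ≈1)) ⟩
      0# + (ω - 2 ×′ 1#) * 0#          ≈⟨ solve 1 (λ ω → # 0 :+ (ω :- # 2) :* # 0 := # 0) refl ω ⟩
      0#                               ∎)
      where
      ζ≈1 : ζ ≈ 1#
      ζ≈1 = *-cancelˡ x≉0 (trans (*-comm x ζ) (trans ζx≈x (sym (*-identityʳ x))))

  _⁻¹ : Carrier → Carrier
  x ⁻¹ with x ≈? 0#
  ... | yes _   = 0#
  ... | no x≉0 = proj₁ (inverse x x≉0)

  *-inverseʳ : ∀ {x} → ¬ x ≈ 0# → x * x ⁻¹ ≈ 1#
  *-inverseʳ {x} x≉0 with x ≈? 0#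
  ... | yes x≈0  = contradiction x≈0 x≉0
  ... | no x≉0′ = proj₂ (inverse x x≉0′)

  ⁻¹-cong : ∀ {x y} → x ≈ y → x ⁻¹ ≈ y ⁻¹
  ⁻¹-cong {x} {y} x≈y with x ≈? 0# | y ≈? 0#
  ... | yes _   | yes _   = refl
  ... | yes x≈0 | no y≉0 = contradiction (trans (sym x≈y) x≈0) y≉0
  ... | no x≉0 | yes y≈0 = contradiction (trans x≈y y≈0) x≉0
  ... | no x≉0 | no y≉0 =
    *-cancelˡ x≉0 (trans (proj₂ (inverse x x≉0)) (sym (trans (*-congʳ x≈y) (proj₂ (inverse y y≉0)))))

  no-Φ₆-root⇒q%3≡2 : (∀ x → ¬ Φ₆ x ≈ 0#) → q % 3 ≡ 2
  no-Φ₆-root⇒q%3≡2 no-root = n≡r+m*d⇒n%d≡r%d $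
    card≡length[mod] prime[3] σ (⁻¹-cong ∘ +-congˡ ∘ -‿cong) (0# ∷ 1# ∷ [])
      ((0≉1 ∷ []) ∷ [] ∷ []) σ-outside σ³x≈x σx≉x
    where
    σ : Carrier → Carrier
    σ x = (1# - x) ⁻¹

    [1-x]σx≈1 : ∀ {x} → ¬ x ≈ 1# → (1# - x) * σ x ≈ 1#
    [1-x]σx≈1 x≉1 = *-inverseʳ (x≉1 ∘ sym ∘ x∙y⁻¹≈ε⇒x≈y _ _)

    Outside : Carrier → Set (c ⊔ ℓ)
    Outside x = All (x ≉_) (0# ∷ 1# ∷ [])

    σ-outside : ∀ {x} → Outside x → Outside (σ x)
    σ-outside {x} (x≉0 ∷ x≉1 ∷ []) = σx≉0 ∷ σx≉1 ∷ []
      where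
      σx≉0 : ¬ σ x ≈ 0#
      σx≉0 σx≈0 = 1≉0 (trans (sym ([1-x]σx≈1 x≉1)) (trans (*-congˡ σx≈0) (zeroʳ _)))
      σx≉1 : ¬ σ x ≈ 1#
      σx≉1 σx≈1 = x≉0 (begin
        x                  ≈⟨ solve 1 (λ x → x := # 1 :- (# 1 :- x) :* # 1) refl x ⟩
        1# - (1# - x) * 1# ≈⟨ +-congˡ (-‿cong (trans (*-congˡ (sym σx≈1)) ([1-x]σx≈1 x≉1))) ⟩
        1# - 1#            ≈⟨ -‿inverseʳ 1# ⟩
        0#                 ∎)

    σ³x≈x : ∀ {x} → Outside x → σ (σ (σ x)) ≈ x
    σ³x≈x {x} x-outside@(_ ∷ x≉1 ∷ []) = *-cancelˡ 1-y₂≉0 (trans ([1-x]σx≈1 y₂≉1) (sym [1-y₂]x≈1))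
      where
      y₁ y₂ : Carrier
      y₁ = σ x
      y₂ = σ y₁
      y₁≉1 : ¬ y₁ ≈ 1#
      y₁≉1 = All.lookup (σ-outside x-outside) (there (here ≡.refl))
      y₂≉1 : ¬ y₂ ≈ 1#
      y₂≉1 = All.lookup (σ-outside (σ-outside x-outside)) (there (here ≡.refl))
      1-y₂≉0 : ¬ 1# - y₂ ≈ 0#
      1-y₂≉0 = y₂≉1 ∘ sym ∘ x∙y⁻¹≈ε⇒x≈y _ _
      [1-y₂]x≈1 : (1# - y₂) * x ≈ 1#
      [1-y₂]x≈1 = begin
        (1# - y₂) * x
          ≈⟨ solve 3 (λ x y₁ y₂ → (# 1 :- y₂) :* x
                := # 1 :+ y₂ :* ((# 1 :- x) :* y₁ :- # 1) :+ (# 1 :- x) :* ((# 1 :- y₁) :* y₂ :- # 1)) refl x y₁ y₂ ⟩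
        1# + y₂ * ((1# - x) * y₁ - 1#) + (1# - x) * ((1# - y₁) * y₂ - 1#)
          ≈⟨ +-cong (+-congˡ (*-congˡ (x≈y⇒x∙y⁻¹≈ε ([1-x]σx≈1 x≉1)))) (*-congˡ (x≈y⇒x∙y⁻¹≈ε ([1-x]σx≈1 y₁≉1))) ⟩
        1# + y₂ * 0# + (1# - x) * 0#
          ≈⟨ solve 2 (λ x y₂ → # 1 :+ y₂ :* # 0 :+ (# 1 :- x) :* # 0 := # 1) refl x y₂ ⟩
        1# ∎

    σx≉x : ∀ {x} → Outside x → ¬ σ x ≈ x
    σx≉x {x} (_ ∷ x≉1 ∷ []) σx≈x = no-root x (begin
      Φ₆ x              ≈⟨ solve 1 (λ x → x :* x :- x :+ # 1 := # 1 :- (# 1 :- x) :* x) refl x ⟩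
      1# - (1# - x) * x ≈⟨ +-congˡ (-‿cong (trans (*-congˡ (sym σx≈x)) ([1-x]σx≈1 x≉1))) ⟩
      1# - 1#           ≈⟨ -‿inverseʳ 1# ⟩
      0#                ∎)

  quadratic : Carrier → Carrier → Carrier → Carrier → Carrier
  quadratic α β γ x = α * (x * x) + β * x + γ

  quadratic-cong : ∀ {α α′ β β′ γ γ′ x} → α ≈ α′ → β ≈ β′ → γ ≈ γ′ →
                   quadratic α β γ x ≈ quadratic α′ β′ γ′ x
  quadratic-cong α≈α′ β≈β′ γ≈γ′ = +-cong (+-cong (*-congʳ α≈α′) (*-congʳ β≈β′)) γ≈γ′

  -- At a root x, αX² + βX + γ = (αX + (αx + β)) (X − x).
  irreducible⇒no-root : ∀ {α β γ} → IrreducibleQuadratic F α β γ → ∀ x → ¬ quadratic α β γ x ≈ 0#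
  irreducible⇒no-root {α} {β} {γ} (α≉0 , no-factors) x root =
    no-factors (α , α * x + β , 1# , - x , α≉0 , 1≉0 , *-identityʳ α , middle , constant)
    where
    middle : α * - x + (α * x + β) * 1# ≈ β
    middle = solve 3 (λ α β x → α :* (:- x) :+ (α :* x :+ β) :* # 1 := β) refl α β x
    constant : (α * x + β) * - x ≈ γ
    constant = begin
      (α * x + β) * - x     ≈⟨ solve 4 (λ α β γ x → (α :* x :+ β) :* (:- x)
                                                 := γ :- (α :* (x :* x) :+ β :* x :+ γ)) refl α β γ x ⟩
      γ - quadratic α β γ x ≈⟨ +-congˡ (-‿cong root) ⟩
      γ - 0#                ≈⟨ solve 1 (λ γ → γ :- # 0 := γ) refl γ ⟩
      γ                     ∎

  no-root⇒irreducible : ∀ {α β γ} → ¬ α ≈ 0# → (∀ x → ¬ quadratic α β γ x ≈ 0#) →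
                        IrreducibleQuadratic F α β γ
  no-root⇒irreducible {α} {β} {γ} α≉0 no-root =
    α≉0 , λ (u , v , w , z , _ , w≉0 , uw≈α , uz+vw≈β , vz≈γ) → no-linear-factor w≉0 uw≈α uz+vw≈β vz≈γ
    where
    no-linear-factor : ∀ {u v w z} → ¬ w ≈ 0# → u * w ≈ α → u * z + v * w ≈ β → v * z ≈ γ → ⊥
    no-linear-factor {u} {v} {w} {z} w≉0 uw≈α uz+vw≈β vz≈γ = no-root x (begin
      quadratic α β γ x                           ≈⟨ quadratic-cong (sym uw≈α) (sym uz+vw≈β) (sym vz≈γ) ⟩
      quadratic (u * w) (u * z + v * w) (v * z) x ≈⟨ solve 5 (λ u v w z x →
                                                       (u :* w) :* (x :* x) :+ (u :* z :+ v :* w) :* x :+ v :* z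
                                                       := (u :* x :+ v) :* (w :* x :+ z)) refl u v w z x ⟩
      (u * x + v) * (w * x + z)                   ≈⟨ *-congˡ wx+z≈0 ⟩
      (u * x + v) * 0#                            ≈⟨ zeroʳ _ ⟩
      0#                                          ∎)
      where
      x : Carrier
      x = - (z * w ⁻¹)
      wx+z≈0 : w * x + z ≈ 0#
      wx+z≈0 = begin
        w * - (z * w ⁻¹) + z ≈⟨ solve 3 (λ w z w⁻¹ → w :* (:- (z :* w⁻¹)) :+ z := z :* (# 1 :- w :* w⁻¹)) refl w z (w ⁻¹) ⟩
        z * (1# - w * w ⁻¹)  ≈⟨ *-congˡ (x≈y⇒x∙y⁻¹≈ε (sym (*-inverseʳ w≉0))) ⟩
        z * 0#               ≈⟨ zeroʳ z ⟩
        0#                   ∎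

  square⇒normal-form : ¬ ι F 2 ≈ 0# → ∀ {s t α β γ} → ¬ t ≈ 0# → IsSquareOfQuadratic F s t α β γ →
                       β ≈ - α × γ ≈ α × t ≈ 1# × s ≈ - ι F 3
  square⇒normal-form 2≉0 {s} {t} {α} {β} {γ} t≉0 (α²≈1 , 2αβ≈-2 , β²+2αγ≈-s , 2βγ≈-2t , γ²≈t) =
    β≈-α , γ≈α , t≈1 , s≈-3
    where
    αβ≈-1 : α * β ≈ - 1#
    αβ≈-1 = *-cancelˡ 2≉0 (begin
      ι F 2 * (α * β) ≈⟨ *-assoc (ι F 2) α β ⟨
      ι F 2 * α * β   ≈⟨ 2αβ≈-2 ⟩
      - ι F 2         ≈⟨ -‿cong (*-identityʳ (ι F 2)) ⟨
      - (ι F 2 * 1#)  ≈⟨ -‿distribʳ-* (ι F 2) 1# ⟩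
      ι F 2 * - 1#    ∎)

    βγ≈-t : β * γ ≈ - t
    βγ≈-t = *-cancelˡ 2≉0 (begin
      ι F 2 * (β * γ) ≈⟨ *-assoc (ι F 2) β γ ⟨
      ι F 2 * β * γ   ≈⟨ 2βγ≈-2t ⟩
      - (ι F 2 * t)   ≈⟨ -‿distribʳ-* (ι F 2) t ⟩
      ι F 2 * - t     ∎)

    β≈-α : β ≈ - α
    β≈-α = begin
      β           ≈⟨ trans (*-congˡ α²≈1) (*-identityʳ β) ⟨
      β * (α * α) ≈⟨ solve 2 (λ α β → β :* (α :* α) := α :* (α :* β)) refl α β ⟩
      α * (α * β) ≈⟨ *-congˡ αβ≈-1 ⟩
      α * - 1#    ≈⟨ solve 1 (λ α → α :* (:- # 1) := :- α) refl α ⟩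
      - α         ∎

    αγ≈t : α * γ ≈ t
    αγ≈t = begin
      α * γ       ≈⟨ solve 2 (λ α γ → α :* γ := :- ((:- α) :* γ)) refl α γ ⟩
      - (- α * γ) ≈⟨ -‿cong (*-congʳ β≈-α) ⟨
      - (β * γ)   ≈⟨ -‿cong βγ≈-t ⟩
      - - t       ≈⟨ -‿involutive t ⟩
      t           ∎

    γ≈αt : γ ≈ α * t
    γ≈αt = begin
      γ           ≈⟨ trans (*-congˡ α²≈1) (*-identityʳ γ) ⟨
      γ * (α * α) ≈⟨ solve 2 (λ α γ → γ :* (α :* α) := α :* (α :* γ)) refl α γ ⟩
      α * (α * γ) ≈⟨ *-congˡ αγ≈t ⟩
      α * t       ∎

    t≈1 : t ≈ 1#
    t≈1 = *-cancelˡ t≉0 (begin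
      t * t             ≈⟨ trans (*-congʳ α²≈1) (*-identityˡ (t * t)) ⟨
      (α * α) * (t * t) ≈⟨ solve 2 (λ α t → (α :* α) :* (t :* t) := (α :* t) :* (α :* t)) refl α t ⟩
      (α * t) * (α * t) ≈⟨ *-cong γ≈αt γ≈αt ⟨
      γ * γ             ≈⟨ γ²≈t ⟩
      t                 ≈⟨ *-identityʳ t ⟨
      t * 1#            ∎)

    γ≈α : γ ≈ α
    γ≈α = trans γ≈αt (trans (*-congˡ t≈1) (*-identityʳ α))

    s≈-3 : s ≈ - ι F 3
    s≈-3 = begin
      s                             ≈⟨ -‿involutive s ⟨
      - - s                         ≈⟨ -‿cong β²+2αγ≈-s ⟨
      - (β * β + ι F 2 * α * γ)     ≈⟨ -‿cong (+-cong (*-cong β≈-α β≈-α) (*-congˡ γ≈α)) ⟩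
      - (- α * - α + ι F 2 * α * α) ≈⟨ -‿cong (solve 2 (λ α two → (:- α) :* (:- α) :+ two :* α :* α
                                                             := (# 1 :+ two) :* (α :* α)) refl α (ι F 2)) ⟩
      - ((1# + ι F 2) * (α * α))    ≈⟨ -‿cong (trans (*-congˡ α²≈1) (*-identityʳ _)) ⟩
      - ι F 3                       ∎

  den≉0⇒t≉0 : ∀ {s t} → ¬ den F s t ≈ 0# → ¬ t ≈ 0#
  den≉0⇒t≉0 den≉0 t≈0 = den≉0 (trans (*-congʳ t≈0) (zeroˡ _))

  den≈-1 : ∀ {s t} → s ≈ - ι F 3 → t ≈ 1# → den F s t ≈ - 1#
  den≈-1 {s} {t} s≈-3 t≈1 = begin
    t * (1# + s + t)             ≈⟨ *-cong t≈1 (+-cong (+-congˡ (trans s≈-3 (-‿cong (ι≈n×1 3)))) t≈1) ⟩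
    1# * (1# + - (3 ×′ 1#) + 1#) ≈⟨ solve 0 (# 1 :* (# 1 :+ :- # 3 :+ # 1) := :- # 1) refl ⟩
    - 1#                         ∎

  [-3]³≈-27 : - ι F 3 * - ι F 3 * - ι F 3 ≈ - ι F 27
  [-3]³≈-27 = begin
    - ι F 3 * - ι F 3 * - ι F 3             ≈⟨ *-cong (*-cong -3≈ -3≈) -3≈ ⟩
    - (3 ×′ 1#) * - (3 ×′ 1#) * - (3 ×′ 1#) ≈⟨ solve 0 ((:- # 3) :* (:- # 3) :* (:- # 3) := :- # 27) refl ⟩
    - (27 ×′ 1#)                            ≈⟨ -‿cong (ι≈n×1 27) ⟨
    - ι F 27                                ∎
    where
    -3≈ : - ι F 3 ≈ - (3 ×′ 1#)
    -3≈ = -‿cong (ι≈n×1 3)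

  θ≈27 : ∀ {θ s t} → θ * den F s t ≈ s * s * s → s ≈ - ι F 3 → t ≈ 1# → θ ≈ ι F 27
  θ≈27 {θ} {s} {t} θden≈s³ s≈-3 t≈1 = -‿injective (begin
    - θ                         ≈⟨ solve 1 (λ θ → :- θ := θ :* (:- # 1)) refl θ ⟩
    θ * - 1#                    ≈⟨ *-congˡ (den≈-1 s≈-3 t≈1) ⟨
    θ * den F s t               ≈⟨ θden≈s³ ⟩
    s * s * s                   ≈⟨ *-cong (*-cong s≈-3 s≈-3) s≈-3 ⟩
    - ι F 3 * - ι F 3 * - ι F 3 ≈⟨ [-3]³≈-27 ⟩
    - ι F 27                    ∎)

  irreducible⇒no-Φ₆-root : ∀ {α β γ} → IrreducibleQuadratic F α β γ → β ≈ - α → γ ≈ α →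
                           ∀ x → ¬ Φ₆ x ≈ 0#
  irreducible⇒no-Φ₆-root {α} {β} {γ} irreducible β≈-α γ≈α x Φ₆x≈0 =
    irreducible⇒no-root irreducible x (begin
      quadratic α β γ x     ≈⟨ quadratic-cong refl β≈-α γ≈α ⟩
      quadratic α (- α) α x ≈⟨ solve 2 (λ α x → α :* (x :* x) :+ (:- α) :* x :+ α
                                                := α :* (x :* x :- x :+ # 1)) refl α x ⟩
      α * Φ₆ x              ≈⟨ *-congˡ Φ₆x≈0 ⟩
      α * 0#                ≈⟨ zeroʳ α ⟩
      0#                    ∎)

  InΘc⇔≈27×no-Φ₆-root : ¬ ι F 2 ≈ 0# → ∀ θ → InΘc F θ ⇔ (θ ≈ ι F 27 × (∀ x → ¬ Φ₆ x ≈ 0#))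
  InΘc⇔≈27×no-Φ₆-root 2≉0 θ = mk⇔ to from
    where
    to : InΘc F θ → θ ≈ ι F 27 × (∀ x → ¬ Φ₆ x ≈ 0#)
    to (s , t , den≉0 , (α , β , γ , irreducible , square) , θden≈s³)
      with β≈-α , γ≈α , t≈1 , s≈-3 ← square⇒normal-form 2≉0 (den≉0⇒t≉0 den≉0) square =
      θ≈27 θden≈s³ s≈-3 t≈1 , irreducible⇒no-Φ₆-root irreducible β≈-α γ≈α

    from : θ ≈ ι F 27 × (∀ x → ¬ Φ₆ x ≈ 0#) → InΘc F θ
    from (θ≈27 , no-root) = - ι F 3 , 1# , den≉0 , (1# , - 1# , 1# , irreducible , square) , θden≈s³
      where
      den≉0 : ¬ den F (- ι F 3) 1# ≈ 0#
      den≉0 den≈0 = 1≉0 (begin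
        1#     ≈⟨ -‿involutive 1# ⟨
        - - 1# ≈⟨ -‿cong (trans (sym (den≈-1 refl refl)) den≈0) ⟩
        - 0#   ≈⟨ -0#≈0# ⟩
        0#     ∎)
      irreducible : IrreducibleQuadratic F 1# (- 1#) 1#
      irreducible = no-root⇒irreducible 1≉0 λ x root → no-root x (trans
        (solve 1 (λ x → x :* x :- x :+ # 1 := # 1 :* (x :* x) :+ (:- # 1) :* x :+ # 1) refl x) root)
      square : IsSquareOfQuadratic F (- ι F 3) 1# 1# (- 1#) 1#
      square = *-identityˡ 1#
             , solve 1 (λ two → two :* # 1 :* (:- # 1) := :- two) refl (ι F 2)
             , solve 1 (λ two → (:- # 1) :* (:- # 1) :+ two :* # 1 :* # 1 := :- (:- (# 1 :+ two))) refl (ι F 2)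
             , solve 1 (λ two → two :* (:- # 1) :* # 1 := :- (two :* # 1)) refl (ι F 2)
             , *-identityˡ 1#
      θden≈s³ : θ * den F (- ι F 3) 1# ≈ - ι F 3 * - ι F 3 * - ι F 3
      θden≈s³ = begin
        θ * den F (- ι F 3) 1#      ≈⟨ *-cong θ≈27 (den≈-1 refl refl) ⟩
        ι F 27 * - 1#               ≈⟨ solve 1 (λ n → n :* (:- # 1) := :- n) refl (ι F 27) ⟩
        - ι F 27                    ≈⟨ [-3]³≈-27 ⟨
        - ι F 3 * - ι F 3 * - ι F 3 ∎


theorem6p19 : ∀ {c ℓ : Level} (p k q : ℕ) → Prime p → 5 ≤ p → 1 ≤ k → q ≡ p ^ k →
    (F : FiniteField c ℓ q) →
      ((q % 6 ≡ 1) → ∀ θ → ¬ InΘc F θ)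
      × ((q % 6 ≢ 1) → ∀ θ → (InΘc F θ ⇔ FiniteField._≈_ F θ (ι F 27)))
theorem6p19 p k q p-prime 5≤p _ q≡pᵏ F = no-θ , θ-is-27
  where
  open FiniteField F using (_≈_; 0#)
  open Equivalence using (to; from)

  r∤q : ∀ {r} → Prime r → r ℕ.< 5 → ¬ r ∣ q
  r∤q r-prime r<5 = prime∤prime^ p-prime r-prime (ℕ.<⇒≢ (ℕ.<-≤-trans r<5 5≤p)) k ∘ ≡.subst (_ ∣_) q≡pᵏ

  2∤q : ¬ 2 ∣ q
  2∤q = r∤q prime[2] (ℕ.s≤s (ℕ.s≤s (ℕ.s≤s ℕ.z≤n)))

  2≉0 : ¬ ι F 2 ≈ 0#
  2≉0 = 2∤q ∘ char∣card F prime[2]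

  3≉0 : ¬ ι F 3 ≈ 0#
  3≉0 = r∤q prime[3] (ℕ.s≤s (ℕ.s≤s (ℕ.s≤s (ℕ.s≤s ℕ.z≤n)))) ∘ char∣card F prime[3]

  no-θ : q % 6 ≡ 1 → ∀ θ → ¬ InΘc F θ
  no-θ q%6≡1 θ θ∈Θc = contradiction (≡.trans (≡.sym q%3≡1) q%3≡2) λ ()
    where
    q%3≡1 : q % 3 ≡ 1
    q%3≡1 = to (%6≡1⇔%3≡1 q 2∤q) q%6≡1
    q%3≡2 : q % 3 ≡ 2
    q%3≡2 = no-Φ₆-root⇒q%3≡2 F (proj₂ (to (InΘc⇔≈27×no-Φ₆-root F 2≉0 θ) θ∈Θc))

  θ-is-27 : q % 6 ≢ 1 → ∀ θ → InΘc F θ ⇔ θ ≈ ι F 27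
  θ-is-27 q%6≢1 θ = mk⇔ (proj₁ ∘ to Θc⇔) (from Θc⇔ ∘ (_, no-root))
    where
    Θc⇔ : InΘc F θ ⇔ (θ ≈ ι F 27 × (∀ x → ¬ Φ₆ F x ≈ 0#))
    Θc⇔ = InΘc⇔≈27×no-Φ₆-root F 2≉0 θ
    no-root : ∀ x → ¬ Φ₆ F x ≈ 0#
    no-root x root = q%6≢1 (from (%6≡1⇔%3≡1 q 2∤q) (Φ₆-root⇒q%3≡1 F 3≉0 root))
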